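{- Let $p$ be an even positive integer and $\tau$ a non-negative integer. Let $\mu=\frac{p^2}{4}+2p+2$, $\gamma=2\mu-\left(\frac p2+4\right)$, $m=\mu+\tau\frac p2$, $g=\gamma+\tau(p-1)$, $c=p\mu+\tau\left(\frac{p^2}{2}-1\right)$, $S(p,\tau)=\langle m,g,g+1\rangle_c$ and $S(p)=S(p,0)$. Then $$\mathrm{W}(S(p,\tau))=\mathrm{W}(S(p))+\tau\left(\frac{p^4}{48}+\frac{3}{16}p^3+\frac{1}{24}p^2+1\right).$$ In particular, $\mathrm{W}(S(p,\tau))>0$.
   Context: A numerical semigroup is a submonoid of $(\mathbb N,+)$ with finite complement. For integers $a_1,\dots,a_r$ and $t$, $\langle a_1,\dots,a_r\rangle_t$ denotes the smallest numerical semigroup containing $a_1,\dots,a_r$ and all integers $\ge t$. For a numerical semigroup $S$ with conductor $c(S)$ (smallest integer such that all integers $\ge c(S)$ are in $S$), let $L=\{s\in S:s<c(S)\}$ and $P$ the set of minimal generators. The Wilf number is $\mathrm{W}(S)=|P|\,|L|-c(S)$. -}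

module Defs where

open import Data.Nat as ℕ using (ℕ; zero; suc; _+_; _*_; _∸_; _^_; _≤_)
open import Data.Nat.DivMod using (_/_)
open import Data.Integer as ℤ using (ℤ; +_)
open import Data.List using (List; []; _∷_; length)
open import Data.Nat.ListAction using (sum)
open import Data.List.Membership.Propositional using (_∈_)
open import Data.List.Relation.Unary.All using (All)
open import Data.List.Relation.Unary.Unique.Propositional using (Unique)
open import Data.Product using (Σ; ∃; ∃-syntax; _×_; _,_)
open import Data.Sum using (_⊎_)
open import Relation.Nullary using (¬_)
open import Relation.Binary.PropositionalEquality using (_≡_; _≢_)

Subset : Set₁
Subset = ℕ → Set

-- ⟨ A ⟩_t : the smallest numerical semigroup containing the elements of A
-- and all integers ≥ t, i.e. finite sums of elements of A (the empty sum
-- giving 0) together with all integers ≥ t.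
⟨_⟩_ : List ℕ → ℕ → Subset
(⟨ A ⟩ t) x = (t ≤ x) ⊎ (Σ (List ℕ) λ xs → All (_∈ A) xs × sum xs ≡ x)

IsConductor : Subset → ℕ → Set
IsConductor S c =
  (∀ n → c ≤ n → S n) × (∀ c' → (∀ n → c' ≤ n → S n) → c ≤ c')

HasSize : Subset → ℕ → Set
HasSize P k = Σ (List ℕ) λ xs →
  Unique xs × (∀ x → (x ∈ xs → P x) × (P x → x ∈ xs)) × length xs ≡ k

SmallElems : Subset → ℕ → Subset
SmallElems S c s = S s × suc s ≤ c

IsMinGen : Subset → Subset
IsMinGen S x = S x × x ≢ 0 ×
  ¬ (∃[ a ] ∃[ b ] (S a × S b × a ≢ 0 × b ≢ 0 × a + b ≡ x))

IsWilf : Subset → ℤ → Set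
IsWilf S w = ∃[ c ] ∃[ l ] ∃[ k ]
  (IsConductor S c × HasSize (SmallElems S c) l × HasSize (IsMinGen S) k
   × w ≡ (+ (k * l)) ℤ.- (+ c))

module _ (p τ : ℕ) where
  h : ℕ
  h = p / 2
  μ : ℕ
  μ = h * h + 2 * p + 2
  γ : ℕ
  γ = 2 * μ ∸ (h + 4)
  mP : ℕ
  mP = μ + τ * h
  gP : ℕ
  gP = γ + τ * (p ∸ 1)
  cP : ℕ
  cP = p * μ + τ * ((p * p) / 2 ∸ 1)

Spt : ℕ → ℕ → Subset
Spt p τ = ⟨ mP p τ ∷ gP p τ ∷ suc (gP p τ) ∷ [] ⟩ cP p τ

module Submission where

-- Write p = 2h, so that g = 2m − d with d = h + 4 + τ, and c = p·m − τ. Below c + m the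
-- elements of S(p, τ) are the sums a·m + b·g + j with 0 ≤ j ≤ b (j of the b copies of g
-- being g + 1); such a sum equals w·m − (b·d − j) for its weight w = a + 2b, and for b ≤ h
-- these values are pairwise distinct and lie in (w·m − m, w·m]. Hence the elements below c
-- are the sums of weight < p and those of weight p with b ≥ 1, and the elements of
-- [c, c + m) that are sums of two nonzero elements are exactly the sums lying there, which
-- come in three explicit shapes; neither count depends on τ. The other elements of
-- [c, c + m) are minimal generators, so the number of minimal generators grows like
-- m = μ + τh while c grows by τ(p²/2 − 1): the Wilf number is affine in τ with the stated
-- slope, and it is positive by a polynomial estimate.

open import Defs hiding (h)
open import Data.Nat as ℕ using (ℕ; _*_; _+_; _^_; _<_)
open import Data.Nat.Divisibility using (_∣_)
open import Data.Integer as ℤ using (ℤ; +_)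
open import Data.Product using (∃-syntax; _×_)
open import Relation.Binary.PropositionalEquality using (_≡_)

open import Data.Nat using (zero; suc; _∸_; _≤_; z≤n; s≤s; _≤?_; _<?_; _≟_)
open import Data.Nat.Properties
open import Data.Nat.DivMod using (_/_; m*n/n≡m)
open import Data.Nat.Divisibility using (divides)
open import Data.Nat.ListAction using (sum)
open import Data.Nat.Tactic.RingSolver using (solve-∀)
open import Data.Integer using (+<+)
import Data.Integer.Properties as ℤ
import Data.Integer.Tactic.RingSolver as ℤ-Solver
open import Data.List using (List; []; _∷_; _++_; map; length; filter; applyUpTo; upTo)
open import Data.List.Properties using (length-map; length-++; length-applyUpTo; length-upTo)
open import Data.List.Membership.Propositional using (_∈_; _∉_)
open import Data.List.Membership.Propositional.Properties
open import Data.List.Membership.Propositional.Properties.WithK using (unique∧set⇒bag)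
open import Data.List.Membership.DecPropositional _≟_ using (_∈?_)
open import Data.List.Relation.Binary.BagAndSetEquality using (∼bag⇒↭)
open import Data.List.Relation.Binary.Permutation.Propositional.Properties using (↭-length)
open import Data.List.Relation.Binary.Disjoint.Propositional using (Disjoint)
open import Data.List.Relation.Unary.Any using (here; there)
open import Data.List.Relation.Unary.All as All using (All; []; _∷_)
import Data.List.Relation.Unary.All.Properties as All
open import Data.List.Relation.Unary.AllPairs using ([]; _∷_)
open import Data.List.Relation.Unary.Unique.Propositional using (Unique)
import Data.List.Relation.Unary.Unique.Propositional.Properties as Unique
open import Data.Product using (∃; _,_; proj₁; proj₂; map₂)
open import Data.Sum using (_⊎_; inj₁; inj₂)
open import Data.Empty using (⊥; ⊥-elim)
open import Function.Bundles using (mk⇔)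
open import Relation.Nullary using (¬_; yes; no)
open import Relation.Unary using (Decidable)
open import Relation.Unary.Properties using (∁?)
open import Relation.Binary using (tri<; tri≈; tri>)
open import Relation.Binary.PropositionalEquality

same-members⇒length-≡ : ∀ {A : Set} {xs ys : List A} → Unique xs → Unique ys →
  (∀ {z} → z ∈ xs → z ∈ ys) → (∀ {z} → z ∈ ys → z ∈ xs) → length xs ≡ length ys
same-members⇒length-≡ ux uy to from = ↭-length (∼bag⇒↭ (unique∧set⇒bag ux uy (mk⇔ to from)))

map⁺-injectiveOn : ∀ {A B : Set} (f : A → B) {xs : List A} → Unique xs →
  (∀ {x y} → x ∈ xs → y ∈ xs → f x ≡ f y → x ≡ y) → Unique (map f xs)
map⁺-injectiveOn f {[]} [] inj = []
map⁺-injectiveOn f {x ∷ xs} (x∉xs ∷ u) inj =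
  All.map⁺ (All.tabulate (λ y∈xs fx≡fy → All.lookup x∉xs y∈xs (inj (here refl) (there y∈xs) fx≡fy)))
  ∷ map⁺-injectiveOn f u (λ p q → inj (there p) (there q))

length-filter+length-filter-∁ : ∀ {A : Set} {P : A → Set} (P? : Decidable P) (xs : List A) →
  length (filter P? xs) + length (filter (∁? P?) xs) ≡ length xs
length-filter+length-filter-∁ P? [] = refl
length-filter+length-filter-∁ P? (x ∷ xs) with P? x
... | yes _ = cong suc (length-filter+length-filter-∁ P? xs)
... | no _ = trans (+-suc _ _) (cong suc (length-filter+length-filter-∁ P? xs))

-- Triples ordered by weight

Triple : Set
Triple = ℕ × ℕ × ℕ

weight : ℕ → ℕ → ℕ
weight a b = a + b * 2
{-# INLINE weight #-}

sucB : Triple → Triple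
sucB (a , b , j) = a , suc b , j

diagonal : ℕ × ℕ → Triple
diagonal (a , b) = a , suc b , suc b

sucB-injective : ∀ {s t} → sucB s ≡ sucB t → s ≡ t
sucB-injective refl = refl

diagonal-injective : ∀ {s t} → diagonal s ≡ diagonal t → s ≡ t
diagonal-injective refl = refl

sucʳ-injective : ∀ {s t : ℕ × ℕ} → map₂ suc s ≡ map₂ suc t → s ≡ t
sucʳ-injective {_ , _} {_ , _} refl = refl

weight-zero : ∀ a → weight a 0 ≡ a
weight-zero = +-identityʳ

weight-suc : ∀ a b → weight a (suc b) ≡ suc (suc (weight a b))
weight-suc a b = trans (+-suc a _) (cong suc (+-suc a _))

pairsOfWeight : ℕ → List (ℕ × ℕ)
pairsOfWeight zero = (0 , 0) ∷ []
pairsOfWeight (suc zero) = (1 , 0) ∷ []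
pairsOfWeight (suc (suc n)) = (suc (suc n) , 0) ∷ map (map₂ suc) (pairsOfWeight n)

-- layer n lists the triples (a , b , j) with j ≤ b of weight n, and layer₊ n those of
-- weight 2 + n with b ≥ 1.
layer : ℕ → List Triple
layer₊ : ℕ → List Triple
layer zero = (0 , 0 , 0) ∷ []
layer (suc zero) = (1 , 0 , 0) ∷ []
layer (suc (suc n)) = (suc (suc n) , 0 , 0) ∷ layer₊ n
layer₊ n = map sucB (layer n) ++ map diagonal (pairsOfWeight n)

weightBelow : ℕ → List Triple
weightBelow zero = []
weightBelow (suc n) = weightBelow n ++ layer n

∈-pairsOfWeight⁺ : ∀ a b → (a , b) ∈ pairsOfWeight (weight a b)
∈-pairsOfWeight⁺ a zero rewrite weight-zero a = head a
  where
  head : ∀ a → (a , 0) ∈ pairsOfWeight a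
  head zero = here refl
  head (suc zero) = here refl
  head (suc (suc a)) = here refl
∈-pairsOfWeight⁺ a (suc b) rewrite weight-suc a b = there (∈-map⁺ (map₂ suc) (∈-pairsOfWeight⁺ a b))

∈-pairsOfWeight⁻ : ∀ n {a b} → (a , b) ∈ pairsOfWeight n → weight a b ≡ n
∈-pairsOfWeight⁻ zero (here refl) = refl
∈-pairsOfWeight⁻ (suc zero) (here refl) = refl
∈-pairsOfWeight⁻ (suc (suc n)) (here refl) = +-identityʳ _
∈-pairsOfWeight⁻ (suc (suc n)) (there p) with ∈-map⁻ (map₂ suc) p
... | (a , b) , q , refl = trans (weight-suc a b) (cong (λ w → suc (suc w)) (∈-pairsOfWeight⁻ n q))

∈-layer⁺ : ∀ a b j → j ≤ b → (a , b , j) ∈ layer (weight a b)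
∈-layer₊⁺ : ∀ a b j → j ≤ suc b → (a , suc b , j) ∈ layer₊ (weight a b)
∈-layer⁺ a zero zero z≤n rewrite weight-zero a = head a
  where
  head : ∀ a → (a , 0 , 0) ∈ layer a
  head zero = here refl
  head (suc zero) = here refl
  head (suc (suc a)) = here refl
∈-layer⁺ a (suc b) j j≤b rewrite weight-suc a b = there (∈-layer₊⁺ a b j j≤b)
∈-layer₊⁺ a b j j≤1+b with m≤n⇒m<n∨m≡n j≤1+b
... | inj₁ (s≤s j≤b) = ∈-++⁺ˡ (∈-map⁺ sucB (∈-layer⁺ a b j j≤b))
... | inj₂ refl = ∈-++⁺ʳ (map sucB (layer (weight a b))) (∈-map⁺ diagonal (∈-pairsOfWeight⁺ a b))

∈-layer⁻ : ∀ n {a b j} → (a , b , j) ∈ layer n → j ≤ b × weight a b ≡ n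
∈-layer₊⁻ : ∀ n {a b j} → (a , b , j) ∈ layer₊ n →
  (∃ λ b′ → b ≡ suc b′) × j ≤ b × weight a b ≡ suc (suc n)
∈-layer⁻ zero (here refl) = z≤n , refl
∈-layer⁻ (suc zero) (here refl) = z≤n , refl
∈-layer⁻ (suc (suc n)) (here refl) = z≤n , +-identityʳ _
∈-layer⁻ (suc (suc n)) (there p) with ∈-layer₊⁻ n p
... | _ , j≤b , weight≡ = j≤b , weight≡
∈-layer₊⁻ n p with ∈-++⁻ (map sucB (layer n)) p
... | inj₁ q with ∈-map⁻ sucB q
...   | (a , b , j) , q′ , refl with ∈-layer⁻ n q′
...     | j≤b , weight≡ =
  (b , refl) , m≤n⇒m≤1+n j≤b , trans (weight-suc a b) (cong (λ w → suc (suc w)) weight≡)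
∈-layer₊⁻ n p | inj₂ q with ∈-map⁻ diagonal q
...   | (a , b) , q′ , refl =
  (b , refl) , ≤-refl , trans (weight-suc a b) (cong (λ w → suc (suc w)) (∈-pairsOfWeight⁻ n q′))

∈-weightBelow⁺ : ∀ n a b j → j ≤ b → weight a b < n → (a , b , j) ∈ weightBelow n
∈-weightBelow⁺ (suc n) a b j j≤b (s≤s w≤n) with m≤n⇒m<n∨m≡n w≤n
... | inj₁ w<n = ∈-++⁺ˡ (∈-weightBelow⁺ n a b j j≤b w<n)
... | inj₂ refl = ∈-++⁺ʳ (weightBelow (weight a b)) (∈-layer⁺ a b j j≤b)

∈-weightBelow⁻ : ∀ n {a b j} → (a , b , j) ∈ weightBelow n → j ≤ b × weight a b < n
∈-weightBelow⁻ (suc n) p with ∈-++⁻ (weightBelow n) p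
... | inj₁ q with ∈-weightBelow⁻ n q
...   | j≤b , w<n = j≤b , m≤n⇒m≤1+n w<n
∈-weightBelow⁻ (suc n) p | inj₂ q with ∈-layer⁻ n q
...   | j≤b , weight≡ = j≤b , s≤s (≤-reflexive weight≡)

pairsOfWeight-unique : ∀ n → Unique (pairsOfWeight n)
pairsOfWeight-unique zero = [] ∷ []
pairsOfWeight-unique (suc zero) = [] ∷ []
pairsOfWeight-unique (suc (suc n)) =
  All.tabulate head∉ ∷ Unique.map⁺ sucʳ-injective (pairsOfWeight-unique n)
  where
  head∉ : ∀ {s} → s ∈ map (map₂ suc) (pairsOfWeight n) → (suc (suc n) , 0) ≢ s
  head∉ p eq with ∈-map⁻ (map₂ suc) p
  head∉ p () | _ , _ , refl

layer-unique : ∀ n → Unique (layer n)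
layer₊-unique : ∀ n → Unique (layer₊ n)
layer-unique zero = [] ∷ []
layer-unique (suc zero) = [] ∷ []
layer-unique (suc (suc n)) = All.tabulate head∉ ∷ layer₊-unique n
  where
  head∉ : ∀ {t} → t ∈ layer₊ n → (suc (suc n) , 0 , 0) ≢ t
  head∉ p eq with ∈-layer₊⁻ n p
  head∉ p () | (_ , refl) , _
layer₊-unique n =
  Unique.++⁺ (Unique.map⁺ sucB-injective (layer-unique n))
             (Unique.map⁺ diagonal-injective (pairsOfWeight-unique n)) disjoint
  where
  disjoint : Disjoint (map sucB (layer n)) (map diagonal (pairsOfWeight n))
  disjoint (p , q) with ∈-map⁻ sucB p | ∈-map⁻ diagonal q
  ... | _ , p′ , refl | _ , _ , refl with ∈-layer⁻ n p′
  ... | j≤b , _ = <-irrefl refl (s≤s j≤b)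

weightBelow-unique : ∀ n → Unique (weightBelow n)
weightBelow-unique zero = []
weightBelow-unique (suc n) = Unique.++⁺ (weightBelow-unique n) (layer-unique n) disjoint
  where
  disjoint : Disjoint (weightBelow n) (layer n)
  disjoint (p , q) with ∈-weightBelow⁻ n p | ∈-layer⁻ n q
  ... | _ , w<n | _ , weight≡ = <-irrefl weight≡ w<n

length-pairsOfWeight-even : ∀ k → length (pairsOfWeight (k * 2)) ≡ suc k
length-pairsOfWeight-even zero = refl
length-pairsOfWeight-even (suc k) =
  cong suc (trans (length-map (map₂ suc) (pairsOfWeight (k * 2))) (length-pairsOfWeight-even k))

length-pairsOfWeight-odd : ∀ k → length (pairsOfWeight (suc (k * 2))) ≡ suc k
length-pairsOfWeight-odd zero = refl
length-pairsOfWeight-odd (suc k) =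
  cong suc (trans (length-map (map₂ suc) (pairsOfWeight (suc (k * 2)))) (length-pairsOfWeight-odd k))

length-layer₊ : ∀ n → length (layer₊ n) ≡ length (layer n) + length (pairsOfWeight n)
length-layer₊ n = trans (length-++ (map sucB (layer n)))
  (cong₂ _+_ (length-map sucB (layer n)) (length-map diagonal (pairsOfWeight n)))

length-layer-odd : ∀ k → length (layer (suc (k * 2))) ≡ length (layer (k * 2))
length-layer-odd zero = refl
length-layer-odd (suc k) = cong suc (begin
  length (layer₊ (suc (k * 2)))
    ≡⟨ length-layer₊ (suc (k * 2)) ⟩
  length (layer (suc (k * 2))) + length (pairsOfWeight (suc (k * 2)))
    ≡⟨ cong₂ _+_ (length-layer-odd k)
         (trans (length-pairsOfWeight-odd k) (sym (length-pairsOfWeight-even k))) ⟩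
  length (layer (k * 2)) + length (pairsOfWeight (k * 2))
    ≡⟨ length-layer₊ (k * 2) ⟨
  length (layer₊ (k * 2)) ∎)
  where open ≡-Reasoning

length-layer-even : ∀ k → 2 * length (layer (k * 2)) ≡ (1 + k) * (2 + k)
length-layer-even zero = refl
length-layer-even (suc k) = begin
  2 * suc (length (layer₊ (k * 2)))
    ≡⟨ cong (λ l → 2 * suc l) (trans (length-layer₊ (k * 2))
         (cong (_+_ (length (layer (k * 2)))) (length-pairsOfWeight-even k))) ⟩
  2 * suc (length (layer (k * 2)) + suc k)
    ≡⟨ regroup (length (layer (k * 2))) k ⟩
  2 * length (layer (k * 2)) + (2 * k + 4)
    ≡⟨ cong (_+ (2 * k + 4)) (length-layer-even k) ⟩
  (1 + k) * (2 + k) + (2 * k + 4)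
    ≡⟨ next-product k ⟩
  (2 + k) * (3 + k) ∎
  where
  open ≡-Reasoning
  regroup : ∀ l k → 2 * (1 + (l + (1 + k))) ≡ 2 * l + (2 * k + 4)
  regroup = solve-∀
  next-product : ∀ k → (1 + k) * (2 + k) + (2 * k + 4) ≡ (2 + k) * (3 + k)
  next-product = solve-∀

length-weightBelow : ∀ k → 3 * length (weightBelow (k * 2)) ≡ k * (1 + k) * (2 + k)
length-weightBelow zero = refl
length-weightBelow (suc k) = begin
  3 * length ((weightBelow (k * 2) ++ layer (k * 2)) ++ layer (suc (k * 2)))
    ≡⟨ cong (3 *_) (trans (length-++ (weightBelow (k * 2) ++ layer (k * 2)))
         (cong₂ _+_ (length-++ (weightBelow (k * 2))) (length-layer-odd k))) ⟩
  3 * ((F + Λ) + Λ)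
    ≡⟨ regroup F Λ ⟩
  3 * F + 3 * (2 * Λ)
    ≡⟨ cong₂ (λ x y → x + 3 * y) (length-weightBelow k) (length-layer-even k) ⟩
  k * (1 + k) * (2 + k) + 3 * ((1 + k) * (2 + k))
    ≡⟨ next-product k ⟩
  (1 + k) * (2 + k) * (3 + k) ∎
  where
  open ≡-Reasoning
  F Λ : ℕ
  F = length (weightBelow (k * 2))
  Λ = length (layer (k * 2))
  regroup : ∀ F L → 3 * ((F + L) + L) ≡ 3 * F + 3 * (2 * L)
  regroup = solve-∀
  next-product : ∀ k → k * (1 + k) * (2 + k) + 3 * ((1 + k) * (2 + k)) ≡ (1 + k) * (2 + k) * (3 + k)
  next-product = solve-∀

HasSize-unique : ∀ {P : Subset} {k l} → HasSize P k → HasSize P l → k ≡ l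
HasSize-unique (xs , xs! , xs≐P , refl) (ys , ys! , ys≐P , refl) =
  same-members⇒length-≡ xs! ys!
    (λ {z} z∈xs → proj₂ (ys≐P z) (proj₁ (xs≐P z) z∈xs))
    (λ {z} z∈ys → proj₂ (xs≐P z) (proj₁ (ys≐P z) z∈ys))

IsConductor-unique : ∀ {S c c′} → IsConductor S c → IsConductor S c′ → c ≡ c′
IsConductor-unique (c-ok , c-least) (c′-ok , c′-least) = ≤-antisym (c-least _ c′-ok) (c′-least _ c-ok)

IsWilf-unique : ∀ {S w w′} → IsWilf S w → IsWilf S w′ → w ≡ w′
IsWilf-unique (c , l , k , C , L , P , refl) (c′ , l′ , k′ , C′ , L′ , P′ , refl)
  with refl ← IsConductor-unique C C′
  rewrite HasSize-unique L L′ | HasSize-unique P P′ = refl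

IsConductor-intro : ∀ {S : Subset} {c} → 1 ≤ c → (∀ n → c ≤ n → S n) →
  (∀ {x} → S x → x < c → suc x < c) → IsConductor S c
IsConductor-intro {S} {suc f} _ above gap = above , least
  where
  least : ∀ c′ → (∀ n → c′ ≤ n → S n) → suc f ≤ c′
  least c′ above′ with suc f ≤? c′
  ... | yes c≤c′ = c≤c′
  ... | no c≰c′ = ⊥-elim (<-irrefl refl (gap (above′ f (≤-pred (≰⇒> c≰c′))) ≤-refl))

≤-by-slack : ∀ {x y s t z} → s ≤ t → x + t + z ≡ y + s → x ≤ y
≤-by-slack {x} {y} {s} {t} {z} s≤t eq =
  +-cancelʳ-≤ t x y (≤-trans (≤-trans (m≤m+n (x + t) z) (≤-reflexive eq)) (+-monoʳ-≤ y s≤t))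

≤-by-slack₀ : ∀ {x y z} → x + z ≡ y → x ≤ y
≤-by-slack₀ {x} {z = z} refl = m≤m+n x z

multiple-in-window-unique : ∀ {v m n n′} → v ≤ n * m → n * m < v + m →
  v ≤ n′ * m → n′ * m < v + m → n ≡ n′
multiple-in-window-unique v≤nm nm<v+m v≤n′m n′m<v+m =
  ≤-antisym (≮⇒≥ (λ n′<n → apart n′<n v≤n′m nm<v+m))
            (≮⇒≥ (λ n<n′ → apart n<n′ v≤nm n′m<v+m))
  where
  apart : ∀ {v m n n′} → n < n′ → v ≤ n * m → n′ * m < v + m → ⊥
  apart {v} {m} {n} {n′} n<n′ v≤nm n′m<v+m = <-irrefl refl (begin-strict
    v + m      ≤⟨ +-monoˡ-≤ m v≤nm ⟩
    n * m + m  ≡⟨ +-comm (n * m) m ⟩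
    suc n * m  ≤⟨ *-monoˡ-≤ m n<n′ ⟩
    n′ * m     <⟨ n′m<v+m ⟩
    v + m      ∎)
    where open ≤-Reasoning

-- The equation says b·d − j = b′·d − j′.
offset-unique : ∀ {d b b′ j j′} → j ≤ b → j′ ≤ b′ → b < d → b′ < d →
  b * d + j′ ≡ b′ * d + j → b ≡ b′
offset-unique j≤b j′≤b′ b<d b′<d eq =
  ≤-antisym (≮⇒≥ (λ b′<b → apart b′<b j≤b b<d (sym eq)))
            (≮⇒≥ (λ b<b′ → apart b<b′ j′≤b′ b′<d eq))
  where
  apart : ∀ {d b b′ j j′} → b < b′ → j′ ≤ b′ → b′ < d → b * d + j′ ≡ b′ * d + j → ⊥
  apart {d} {b} {b′} {j} {j′} b<b′ j′≤b′ b′<d eq = <-irrefl eq (begin-strict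
    b * d + j′   ≤⟨ +-monoʳ-≤ (b * d) j′≤b′ ⟩
    b * d + b′   <⟨ +-monoʳ-< (b * d) b′<d ⟩
    b * d + d    ≡⟨ +-comm (b * d) d ⟩
    suc b * d    ≤⟨ *-monoˡ-≤ d b<b′ ⟩
    b′ * d       ≤⟨ m≤m+n (b′ * d) j ⟩
    b′ * d + j   ∎)
    where open ≤-Reasoning

half-≤ : ∀ {b h r} → r ≤ 1 → b * 2 ≤ r + h * 2 → b ≤ h
half-≤ {b} {h} {r} r≤1 b2≤r+h2 = ≮⇒≥ λ h<b → <-irrefl refl (begin-strict
  h * 2 + 2      ≡⟨ +-comm (h * 2) 2 ⟩
  suc h * 2      ≤⟨ *-monoˡ-≤ 2 h<b ⟩
  b * 2          ≤⟨ b2≤r+h2 ⟩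
  r + h * 2      <⟨ +-monoˡ-< (h * 2) (s≤s r≤1) ⟩
  2 + h * 2      ≡⟨ +-comm 2 (h * 2) ⟩
  h * 2 + 2      ∎)
  where open ≤-Reasoning

n<m⇒0<+m-+n : ∀ {m n} → n < m → + 0 ℤ.< + m ℤ.- + n
n<m⇒0<+m-+n {m} {n} n<m =
  subst (+ 0 ℤ.<_) (sym (trans (ℤ.m-n≡m⊖n m n) (ℤ.⊖-≥ (<⇒≤ n<m)))) (+<+ (m+n≤o⇒m≤o∸n 1 n<m))

*-difference-shift : ∀ k {A B A₀ B₀ X} → k * A + k * B₀ ≡ k * A₀ + k * B + X →
  + k ℤ.* (+ A ℤ.- + B) ≡ + k ℤ.* (+ A₀ ℤ.- + B₀) ℤ.+ + X
*-difference-shift k {A} {B} {A₀} {B₀} {X} eq = begin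
  + k ℤ.* (+ A ℤ.- + B)
    ≡⟨ regroupˡ (+ k) (+ A) (+ B) (+ B₀) ⟩
  (+ k ℤ.* + A ℤ.+ + k ℤ.* + B₀) ℤ.- + k ℤ.* + B ℤ.- + k ℤ.* + B₀
    ≡⟨ cong (λ z → z ℤ.- + k ℤ.* + B ℤ.- + k ℤ.* + B₀) eqℤ ⟩
  (+ k ℤ.* + A₀ ℤ.+ + k ℤ.* + B ℤ.+ + X) ℤ.- + k ℤ.* + B ℤ.- + k ℤ.* + B₀
    ≡⟨ regroupʳ (+ k) (+ A₀) (+ B) (+ B₀) (+ X) ⟩
  + k ℤ.* (+ A₀ ℤ.- + B₀) ℤ.+ + X ∎
  where
  open ≡-Reasoning
  eqℤ : + k ℤ.* + A ℤ.+ + k ℤ.* + B₀ ≡ + k ℤ.* + A₀ ℤ.+ + k ℤ.* + B ℤ.+ + X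
  eqℤ = begin
    + k ℤ.* + A ℤ.+ + k ℤ.* + B₀         ≡⟨ cong₂ ℤ._+_ (ℤ.pos-* k A) (ℤ.pos-* k B₀) ⟨
    + (k * A) ℤ.+ + (k * B₀)             ≡⟨ ℤ.pos-+ (k * A) (k * B₀) ⟨
    + (k * A + k * B₀)                   ≡⟨ cong +_ eq ⟩
    + (k * A₀ + k * B + X)               ≡⟨ ℤ.pos-+ (k * A₀ + k * B) X ⟩
    + (k * A₀ + k * B) ℤ.+ + X           ≡⟨ cong (ℤ._+ + X) (ℤ.pos-+ (k * A₀) (k * B)) ⟩
    + (k * A₀) ℤ.+ + (k * B) ℤ.+ + X
      ≡⟨ cong (ℤ._+ + X) (cong₂ ℤ._+_ (ℤ.pos-* k A₀) (ℤ.pos-* k B)) ⟩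
    + k ℤ.* + A₀ ℤ.+ + k ℤ.* + B ℤ.+ + X ∎
  regroupˡ : ∀ k a b b₀ → k ℤ.* (a ℤ.- b) ≡ (k ℤ.* a ℤ.+ k ℤ.* b₀) ℤ.- k ℤ.* b ℤ.- k ℤ.* b₀
  regroupˡ = ℤ-Solver.solve-∀
  regroupʳ : ∀ k a₀ b b₀ x →
    (k ℤ.* a₀ ℤ.+ k ℤ.* b ℤ.+ x) ℤ.- k ℤ.* b ℤ.- k ℤ.* b₀ ≡ k ℤ.* (a₀ ℤ.- b₀) ℤ.+ x
  regroupʳ = ℤ-Solver.solve-∀

-- The semigroup S(p, τ)

-- The parameters of S(p, τ) for p = h * 2 as polynomials in u = h − 1 and τ, with
-- d = 2m − g; the INLINE pragmas let the ring solver see through these names.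
module Params (u τ : ℕ) where
  h : ℕ
  h = suc u
  {-# INLINE h #-}
  p : ℕ
  p = h * 2
  {-# INLINE p #-}
  d : ℕ
  d = u + 5 + τ
  {-# INLINE d #-}
  m : ℕ
  m = h * d + 2
  {-# INLINE m #-}
  g : ℕ
  g = (2 * u + 1) * d + 4
  {-# INLINE g #-}
  c : ℕ
  c = (2 * u * u + 4 * u + 1) * d + 5 * u + 9
  {-# INLINE c #-}

  value : ℕ → ℕ → ℕ → ℕ
  value a b j = a * m + b * g + j
  {-# INLINE value #-}

  ⟦_⟧ : Triple → ℕ
  ⟦ a , b , j ⟧ = value a b j

-- Ring identities used below; in those behind an inequality, the last summand on the left
-- is the (visibly non-negative) slack.
module Identities where
  value-weight : ∀ u τ a b j → let open Params u τ in value a b j + b * d ≡ weight a b * m + j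
  value-weight = solve-∀
  value-+ : ∀ u τ a b j a′ b′ j′ → let open Params u τ in
    value (a + a′) (b + b′) (j + j′) ≡ value a b j + value a′ b′ j′
  value-+ = solve-∀
  value-sucᵃ : ∀ u τ a b j → let open Params u τ in value (suc a) b j ≡ m + value a b j
  value-sucᵃ = solve-∀
  value-sucᵇ : ∀ u τ a b j → let open Params u τ in value a (suc b) j ≡ g + value a b j
  value-sucᵇ = solve-∀
  value-sucᵇʲ : ∀ u τ a b j → let open Params u τ in value a (suc b) (suc j) ≡ suc g + value a b j
  value-sucᵇʲ = solve-∀

  light : ∀ u τ a b j → let open Params u τ in
    2 + value a b j + (p * m + b) + (u * u + 6 * u + u * τ + 5 + b * (u + 4 + τ))
      ≡ c + ((1 + weight a b) * m + j)
  light = solve-∀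
  weight-p : ∀ u τ a b j → let open Params u τ in
    2 + value a (suc b) j + (p * m + suc b) + (u + 2 + b * (u + 4 + τ))
      ≡ c + (weight a (suc b) * m + j)
  weight-p = solve-∀
  h<b : ∀ u τ a b j → let open Params u τ in
    c + b * g + (4 + 7 * a + j + 5 * u + τ + 6 * a * u + a * τ + u * u + u * τ + a * u * u + a * u * τ)
      ≡ value a b j + suc h * g
  h<b = solve-∀
  heavy : ∀ u τ a b j → let open Params u τ in
    c + (weight a b * m + h * d) + (2 + j + τ) ≡ value a b j + ((1 + p) * m + b * d)
  heavy = solve-∀
  weight-p+1 : ∀ u τ a b j → let open Params u τ in
    c + (h * d + weight a (suc b) * m) + (2 + j + τ) ≡ value a (suc b) j + (suc b * d + (1 + p) * m)
  weight-p+1 = solve-∀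
  weight-p+1<c+m : ∀ u τ a b j → let open Params u τ in
    suc (value a (suc b) j) + (suc b + (1 + p) * m) + (u + 3 + b * (u + 4 + τ))
      ≡ c + m + (j + weight a (suc b) * m)
  weight-p+1<c+m = solve-∀
  weight-p+1-separation : ∀ u τ a b j → let open Params u τ in
    value a (suc b) j + d + (suc b + (1 + p) * m) + b * (u + 4 + τ)
      ≡ suc ((1 + p) * m) + (j + weight a (suc b) * m)
  weight-p+1-separation = solve-∀
  top<c+m : ∀ u τ j → let open Params u τ in
    suc (value 0 (suc h) j) + suc h + 0 ≡ c + m + j
  top<c+m = solve-∀
  h+1<b : ∀ u τ a b j → let open Params u τ in
    c + m + b * g + (6 + 7 * a + j + 10 * u + τ + 6 * a * u + a * τ + 2 * u * u + 2 * u * τ + a * u * u + a * u * τ)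
      ≡ value a b j + (2 + h) * g
  h+1<b = solve-∀
  heavier : ∀ u τ a b j → let open Params u τ in
    c + m + (weight a b * m + h * d) + (2 + j + τ) ≡ value a b j + ((2 + p) * m + b * d)
  heavier = solve-∀
  value≤weight*m : ∀ u τ a b j → let open Params u τ in
    value a b j + b + b * (u + 4 + τ) ≡ weight a b * m + j
  value≤weight*m = solve-∀
  weight*m<value+m : ∀ u τ a b j → let open Params u τ in
    suc (weight a b * m) + h * d + (1 + j) ≡ value a b j + m + b * d
  weight*m<value+m = solve-∀

  c≤value[p,0,0] : ∀ u τ → let open Params u τ in c + τ ≡ value p 0 0
  c≤value[p,0,0] = solve-∀
  value[p,0,0]<c+m : ∀ u τ → let open Params u τ in
    suc (value p 0 0) + (6 + 6 * u + u * u + u * τ) ≡ c + m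
  value[p,0,0]<c+m = solve-∀
  [p,0,0]-separation : ∀ u τ → let open Params u τ in
    value p 0 0 + d + (3 + 5 * u + u * u + u * τ) ≡ suc ((1 + p) * m)
  [p,0,0]-separation = solve-∀
  c+m≤value[p+1,0,0] : ∀ u τ → let open Params u τ in c + m + τ ≡ value (suc p) 0 0
  c+m≤value[p+1,0,0] = solve-∀
  c≤top : ∀ u τ j → let open Params u τ in
    c + (4 + j + 5 * u + τ + u * u + u * τ) ≡ value 0 (suc h) j
  c≤top = solve-∀
  top-separation : ∀ u τ j → let open Params u τ in
    suc (suc ((1 + p) * m)) + j ≡ value 0 (suc h) j + d
  top-separation = solve-∀
  c+m≤[a+1,h+1,j] : ∀ u τ a j → let open Params u τ in
    c + m + (4 + 7 * a + j + 5 * u + τ + 6 * a * u + a * τ + u * u + u * τ + a * u * u + a * u * τ)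
      ≡ value (suc a) (suc h) j
  c+m≤[a+1,h+1,j] = solve-∀

  m≤c : ∀ u τ → let open Params u τ in
    m + (7 + 20 * u + 13 * u * u + 3 * u * τ + 2 * u * u * u + 2 * u * u * τ) ≡ c
  m≤c = solve-∀
  g+2≤c : ∀ u τ → let open Params u τ in
    2 + g + (3 + 15 * u + 12 * u * u + 2 * u * τ + 2 * u * u * u + 2 * u * u * τ) ≡ c
  g+2≤c = solve-∀
  m<g : ∀ u τ → let open Params u τ in suc m + (1 + 5 * u + u * u + u * τ) ≡ g
  m<g = solve-∀
  g+2≤2m : ∀ u τ → let open Params u τ in 2 + g + (3 + u + τ) ≡ 2 * m
  g+2≤2m = solve-∀
  h<d : ∀ u τ → let open Params u τ in suc h + (3 + τ) ≡ d
  h<d = solve-∀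

module Family (u τ : ℕ) where
  open Params u τ public

  value-weight : ∀ a b j → value a b j + b * d ≡ weight a b * m + j
  value-weight = Identities.value-weight u τ

  light⇒value+2≤c : ∀ a b j → j ≤ b → suc (weight a b) ≤ p → 2 + value a b j ≤ c
  light⇒value+2≤c a b j j≤b w<p =
    ≤-by-slack (+-mono-≤ (*-monoˡ-≤ m w<p) j≤b) (Identities.light u τ a b j)

  weight-p⇒value+2≤c : ∀ a b j → j ≤ suc b → weight a (suc b) ≡ p → 2 + value a (suc b) j ≤ c
  weight-p⇒value+2≤c a b j j≤b w≡p =
    ≤-by-slack (+-mono-≤ (*-monoˡ-≤ m (≤-reflexive w≡p)) j≤b) (Identities.weight-p u τ a b j)

  h<b⇒c≤value : ∀ a b j → h < b → c ≤ value a b j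
  h<b⇒c≤value a b j h<b = ≤-by-slack (*-monoˡ-≤ g h<b) (Identities.h<b u τ a b j)

  heavy⇒c≤value : ∀ a b j → b ≤ h → p < weight a b → c ≤ value a b j
  heavy⇒c≤value a b j b≤h p<w =
    ≤-by-slack (+-mono-≤ (*-monoˡ-≤ m p<w) (*-monoˡ-≤ d b≤h)) (Identities.heavy u τ a b j)

  weight-p+1⇒c≤value : ∀ a b j → suc b ≤ h → weight a (suc b) ≡ suc p → c ≤ value a (suc b) j
  weight-p+1⇒c≤value a b j b<h w≡p+1 =
    ≤-by-slack (+-mono-≤ (*-monoˡ-≤ d b<h) (*-monoˡ-≤ m (≤-reflexive (sym w≡p+1))))
      (Identities.weight-p+1 u τ a b j)

  weight-p+1⇒value<c+m : ∀ a b j → j ≤ suc b → weight a (suc b) ≡ suc p →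
    value a (suc b) j < c + m
  weight-p+1⇒value<c+m a b j j≤b w≡p+1 =
    ≤-by-slack (+-mono-≤ j≤b (*-monoˡ-≤ m (≤-reflexive w≡p+1))) (Identities.weight-p+1<c+m u τ a b j)

  weight-p+1⇒value+d≤1+[p+1]m : ∀ a b j → j ≤ suc b → weight a (suc b) ≡ suc p →
    value a (suc b) j + d ≤ suc ((1 + p) * m)
  weight-p+1⇒value+d≤1+[p+1]m a b j j≤b w≡p+1 =
    ≤-by-slack (+-mono-≤ j≤b (*-monoˡ-≤ m (≤-reflexive w≡p+1))) (Identities.weight-p+1-separation u τ a b j)

  c+m≤value[p+1,0,0] : c + m ≤ value (suc p) 0 0
  c+m≤value[p+1,0,0] = ≤-by-slack₀ (Identities.c+m≤value[p+1,0,0] u τ)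

  c≤value[p,0,0] : c ≤ value p 0 0
  c≤value[p,0,0] = ≤-by-slack₀ (Identities.c≤value[p,0,0] u τ)

  value[p,0,0]<c+m : value p 0 0 < c + m
  value[p,0,0]<c+m = ≤-by-slack₀ (Identities.value[p,0,0]<c+m u τ)

  value[p,0,0]+d≤1+[p+1]m : value p 0 0 + d ≤ suc ((1 + p) * m)
  value[p,0,0]+d≤1+[p+1]m = ≤-by-slack₀ (Identities.[p,0,0]-separation u τ)

  c≤value[0,h+1,j] : ∀ j → c ≤ value 0 (suc h) j
  c≤value[0,h+1,j] j = ≤-by-slack₀ (Identities.c≤top u τ j)

  value[0,h+1,j]<c+m : ∀ j → j ≤ suc h → value 0 (suc h) j < c + m
  value[0,h+1,j]<c+m j j≤h+1 = ≤-by-slack j≤h+1 (Identities.top<c+m u τ j)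

  1+[p+1]m<value[0,h+1,j]+d : ∀ j → suc ((1 + p) * m) < value 0 (suc h) j + d
  1+[p+1]m<value[0,h+1,j]+d j = ≤-by-slack₀ (Identities.top-separation u τ j)

  h+1<b⇒c+m≤value : ∀ a b j → suc h < b → c + m ≤ value a b j
  h+1<b⇒c+m≤value a b j h+1<b = ≤-by-slack (*-monoˡ-≤ g h+1<b) (Identities.h+1<b u τ a b j)

  c+m≤value[a+1,h+1,j] : ∀ a j → c + m ≤ value (suc a) (suc h) j
  c+m≤value[a+1,h+1,j] a j = ≤-by-slack₀ (Identities.c+m≤[a+1,h+1,j] u τ a j)

  heavier⇒c+m≤value : ∀ a b j → b ≤ h → suc p < weight a b → c + m ≤ value a b j
  heavier⇒c+m≤value a b j b≤h p+1<w =
    ≤-by-slack (+-mono-≤ (*-monoˡ-≤ m p+1<w) (*-monoˡ-≤ d b≤h)) (Identities.heavier u τ a b j)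

  value≤weight*m : ∀ a b j → j ≤ b → value a b j ≤ weight a b * m
  value≤weight*m a b j j≤b = ≤-by-slack j≤b (Identities.value≤weight*m u τ a b j)

  weight*m<value+m : ∀ a b j → b ≤ h → weight a b * m < value a b j + m
  weight*m<value+m a b j b≤h = ≤-by-slack (*-monoˡ-≤ d b≤h) (Identities.weight*m<value+m u τ a b j)

  m≤c : m ≤ c
  m≤c = ≤-by-slack₀ (Identities.m≤c u τ)

  g+2≤c : 2 + g ≤ c
  g+2≤c = ≤-by-slack₀ (Identities.g+2≤c u τ)

  m<g : m < g
  m<g = ≤-by-slack₀ (Identities.m<g u τ)

  g+2≤2m : 2 + g ≤ 2 * m
  g+2≤2m = ≤-by-slack₀ (Identities.g+2≤2m u τ)

  h<d : h < d
  h<d = ≤-by-slack₀ (Identities.h<d u τ)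

  0<m : 0 < m
  0<m = ≤-trans (s≤s z≤n) (m≤n+m 2 (h * d))

  value-injective : ∀ {a b j a′ b′ j′} → j ≤ b → b ≤ h → j′ ≤ b′ → b′ ≤ h →
    value a b j ≡ value a′ b′ j′ → (a , b , j) ≡ (a′ , b′ , j′)
  value-injective {a} {b} {j} {a′} {b′} {j′} j≤b b≤h j′≤b′ b′≤h eq =
    cong₂ _,_ a≡a′ (cong₂ _,_ b≡b′ j≡j′)
    where
    w : ℕ
    w = weight a b
    weights : weight a b ≡ weight a′ b′
    weights = multiple-in-window-unique
      (value≤weight*m a b j j≤b) (weight*m<value+m a b j b≤h)
      (subst (_≤ weight a′ b′ * m) (sym eq) (value≤weight*m a′ b′ j′ j′≤b′))
      (subst (λ v → weight a′ b′ * m < v + m) (sym eq) (weight*m<value+m a′ b′ j′ b′≤h))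
    offsets : b * d + j′ ≡ b′ * d + j
    offsets = +-cancelˡ-≡ (value a b j) _ _ (begin
      value a b j + (b * d + j′)       ≡⟨ +-assoc (value a b j) (b * d) j′ ⟨
      value a b j + b * d + j′         ≡⟨ cong (_+ j′) (value-weight a b j) ⟩
      w * m + j + j′                   ≡⟨ +-assoc (w * m) j j′ ⟩
      w * m + (j + j′)                 ≡⟨ cong (_+_ (w * m)) (+-comm j j′) ⟩
      w * m + (j′ + j)                 ≡⟨ +-assoc (w * m) j′ j ⟨
      w * m + j′ + j                   ≡⟨ cong (λ v → v * m + j′ + j) weights ⟩
      weight a′ b′ * m + j′ + j       ≡⟨ cong (_+ j) (value-weight a′ b′ j′) ⟨
      value a′ b′ j′ + b′ * d + j      ≡⟨ cong (λ v → v + b′ * d + j) eq ⟨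
      value a b j + b′ * d + j         ≡⟨ +-assoc (value a b j) (b′ * d) j ⟩
      value a b j + (b′ * d + j)       ∎)
      where open ≡-Reasoning
    b≡b′ : b ≡ b′
    b≡b′ = offset-unique j≤b j′≤b′ (≤-<-trans b≤h h<d) (≤-<-trans b′≤h h<d) offsets
    j≡j′ : j ≡ j′
    j≡j′ = sym (+-cancelˡ-≡ (b * d) _ _ (trans offsets (cong (λ x → x * d + j) (sym b≡b′))))
    a≡a′ : a ≡ a′
    a≡a′ = +-cancelʳ-≡ (b * 2) _ _ (trans weights (cong (λ x → weight a′ x) (sym b≡b′)))

  private
    c≤v⇒v+2≰c : ∀ {v} → c ≤ v → ¬ (2 + v ≤ c)
    c≤v⇒v+2≰c c≤v v+2≤c = <⇒≱ (≤-trans (n≤1+n _) v+2≤c) c≤v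

  smallTriples : List Triple
  smallTriples = weightBelow p ++ layer₊ (u * 2)

  ∈-smallTriples⁻ : ∀ {a b j} → (a , b , j) ∈ smallTriples → j ≤ b × b ≤ h × 2 + value a b j ≤ c
  ∈-smallTriples⁻ {a} {b} {j} t∈ with ∈-++⁻ (weightBelow p) t∈
  ... | inj₁ t∈below with ∈-weightBelow⁻ p t∈below
  ...   | j≤b , w<p =
    j≤b , half-≤ z≤n (≤-trans (m≤n+m (b * 2) a) (<⇒≤ w<p)) , light⇒value+2≤c a b j j≤b w<p
  ∈-smallTriples⁻ {a} {b} {j} t∈ | inj₂ t∈layer with ∈-layer₊⁻ (u * 2) t∈layer
  ...   | (b′ , refl) , j≤b , w≡p =
    j≤b , half-≤ z≤n (≤-trans (m≤n+m (b * 2) a) (≤-reflexive w≡p)) , weight-p⇒value+2≤c a b′ j j≤b w≡p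

  weight-p∧value<c⇒∈layer₊ : ∀ a b j → j ≤ b → weight a b ≡ p → value a b j < c →
    (a , b , j) ∈ layer₊ (u * 2)
  weight-p∧value<c⇒∈layer₊ a zero zero z≤n w≡p v<c rewrite trans (sym (weight-zero a)) w≡p =
    ⊥-elim (<⇒≱ v<c c≤value[p,0,0])
  weight-p∧value<c⇒∈layer₊ a (suc b) j j≤b w≡p _ =
    subst (λ n → (a , suc b , j) ∈ layer₊ n)
      (suc-injective (suc-injective (trans (sym (weight-suc a b)) w≡p))) (∈-layer₊⁺ a b j j≤b)

  ∈-smallTriples⁺ : ∀ a b j → j ≤ b → value a b j < c → (a , b , j) ∈ smallTriples
  ∈-smallTriples⁺ a b j j≤b v<c with h <? b
  ... | yes h<b = ⊥-elim (<⇒≱ v<c (h<b⇒c≤value a b j h<b))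
  ... | no h≮b with <-cmp (weight a b) p
  ...   | tri< w<p _ _ = ∈-++⁺ˡ (∈-weightBelow⁺ p a b j j≤b w<p)
  ...   | tri≈ _ w≡p _ = ∈-++⁺ʳ (weightBelow p) (weight-p∧value<c⇒∈layer₊ a b j j≤b w≡p v<c)
  ...   | tri> _ _ p<w = ⊥-elim (<⇒≱ v<c (heavy⇒c≤value a b j (≮⇒≥ h≮b) p<w))

  top : ℕ → Triple
  top j = 0 , suc h , j

  coverTriples : List Triple
  coverTriples = (p , 0 , 0) ∷ layer₊ (suc (u * 2)) ++ map top (upTo (suc (suc h)))

  -- The bound in the first case separates these values from those of the top triples.
  InCover : Triple → Set
  InCover (a , b , j) = j ≤ b × c ≤ value a b j × value a b j < c + m ×
    ((b ≤ h × value a b j + d ≤ suc ((1 + p) * m)) ⊎ (a ≡ 0 × b ≡ suc h))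

  ∈-coverTriples⁻ : ∀ {a b j} → (a , b , j) ∈ coverTriples → InCover (a , b , j)
  ∈-coverTriples⁻ (here refl) =
    z≤n , c≤value[p,0,0] , value[p,0,0]<c+m , inj₁ (z≤n , value[p,0,0]+d≤1+[p+1]m)
  ∈-coverTriples⁻ {a} {b} {j} (there t∈) with ∈-++⁻ (layer₊ (suc (u * 2))) t∈
  ... | inj₁ t∈layer with ∈-layer₊⁻ (suc (u * 2)) t∈layer
  ...   | (b′ , refl) , j≤b , w≡p+1 =
    j≤b , weight-p+1⇒c≤value a b′ j b<h w≡p+1 , weight-p+1⇒value<c+m a b′ j j≤b w≡p+1 ,
    inj₁ (b<h , weight-p+1⇒value+d≤1+[p+1]m a b′ j j≤b w≡p+1)
    where
    b<h : suc b′ ≤ h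
    b<h = half-≤ (s≤s z≤n) (≤-trans (m≤n+m (suc b′ * 2) a) (≤-reflexive w≡p+1))
  ∈-coverTriples⁻ (there t∈) | inj₂ t∈top with ∈-map⁻ top t∈top
  ...   | j , j∈ , refl = let j≤h+1 = ≤-pred (∈-upTo⁻ j∈) in
    j≤h+1 , c≤value[0,h+1,j] j , value[0,h+1,j]<c+m j j≤h+1 , inj₂ (refl , refl)

  weight-p∧c≤value⇒≡head : ∀ a b j → j ≤ b → weight a b ≡ p → c ≤ value a b j →
    (a , b , j) ≡ (p , 0 , 0)
  weight-p∧c≤value⇒≡head a zero zero z≤n w≡p _ = cong (_, 0 , 0) (trans (sym (weight-zero a)) w≡p)
  weight-p∧c≤value⇒≡head a (suc b) j j≤b w≡p c≤v =
    ⊥-elim (c≤v⇒v+2≰c c≤v (weight-p⇒value+2≤c a b j j≤b w≡p))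

  weight-p+1∧value<c+m⇒∈layer₊ : ∀ a b j → j ≤ b → weight a b ≡ suc p → value a b j < c + m →
    (a , b , j) ∈ layer₊ (suc (u * 2))
  weight-p+1∧value<c+m⇒∈layer₊ a zero zero z≤n w≡p+1 v<c+m
    rewrite trans (sym (weight-zero a)) w≡p+1 = ⊥-elim (<⇒≱ v<c+m c+m≤value[p+1,0,0])
  weight-p+1∧value<c+m⇒∈layer₊ a (suc b) j j≤b w≡p+1 _ =
    subst (λ n → (a , suc b , j) ∈ layer₊ n)
      (suc-injective (suc-injective (trans (sym (weight-suc a b)) w≡p+1))) (∈-layer₊⁺ a b j j≤b)

  b≡h+1∧value<c+m⇒≡top : ∀ a j → j ≤ suc h → value a (suc h) j < c + m → (a , suc h , j) ≡ top j
  b≡h+1∧value<c+m⇒≡top zero j _ _ = refl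
  b≡h+1∧value<c+m⇒≡top (suc a) j _ v<c+m = ⊥-elim (<⇒≱ v<c+m (c+m≤value[a+1,h+1,j] a j))

  ∈-coverTriples⁺ : ∀ a b j → j ≤ b → c ≤ value a b j → value a b j < c + m → (a , b , j) ∈ coverTriples
  ∈-coverTriples⁺ a b j j≤b c≤v v<c+m with suc h <? b
  ... | yes h+1<b = ⊥-elim (<⇒≱ v<c+m (h+1<b⇒c+m≤value a b j h+1<b))
  ... | no h+1≮b with m≤n⇒m<n∨m≡n (≮⇒≥ h+1≮b)
  ...   | inj₂ refl rewrite b≡h+1∧value<c+m⇒≡top a j j≤b v<c+m =
    there (∈-++⁺ʳ (layer₊ (suc (u * 2))) (∈-map⁺ top (∈-upTo⁺ (s≤s j≤b))))
  ...   | inj₁ (s≤s b≤h) with <-cmp (weight a b) p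
  ...     | tri< w<p _ _ = ⊥-elim (c≤v⇒v+2≰c c≤v (light⇒value+2≤c a b j j≤b w<p))
  ...     | tri≈ _ w≡p _ rewrite weight-p∧c≤value⇒≡head a b j j≤b w≡p c≤v = here refl
  ...     | tri> _ _ p<w with m≤n⇒m<n∨m≡n p<w
  ...       | inj₁ p+1<w = ⊥-elim (<⇒≱ v<c+m (heavier⇒c+m≤value a b j b≤h p+1<w))
  ...       | inj₂ p+1≡w = there (∈-++⁺ˡ (weight-p+1∧value<c+m⇒∈layer₊ a b j j≤b (sym p+1≡w) v<c+m))

  smallTriples-unique : Unique smallTriples
  smallTriples-unique = Unique.++⁺ (weightBelow-unique p) (layer₊-unique (u * 2)) disjoint
    where
    disjoint : Disjoint (weightBelow p) (layer₊ (u * 2))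
    disjoint (s∈ , t∈) with ∈-weightBelow⁻ p s∈ | ∈-layer₊⁻ (u * 2) t∈
    ... | _ , w<p | _ , _ , w≡p = <-irrefl w≡p w<p

  coverTriples-unique : Unique coverTriples
  coverTriples-unique =
    All.tabulate head∉ ∷
      Unique.++⁺ (layer₊-unique (suc (u * 2))) (Unique.map⁺ top-injective (Unique.upTo⁺ (suc (suc h)))) disjoint
    where
    top-injective : ∀ {i j} → top i ≡ top j → i ≡ j
    top-injective refl = refl
    head∉ : ∀ {t} → t ∈ layer₊ (suc (u * 2)) ++ map top (upTo (suc (suc h))) → (p , 0 , 0) ≢ t
    head∉ t∈ refl with ∈-++⁻ (layer₊ (suc (u * 2))) t∈
    ... | inj₁ t∈layer with ∈-layer₊⁻ (suc (u * 2)) t∈layer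
    ...   | (_ , ()) , _
    head∉ t∈ refl | inj₂ t∈top with ∈-map⁻ top t∈top
    ...   | _ , _ , ()
    disjoint : Disjoint (layer₊ (suc (u * 2))) (map top (upTo (suc (suc h))))
    disjoint (s∈ , t∈) with ∈-map⁻ top t∈
    ... | _ , _ , refl with ∈-layer₊⁻ (suc (u * 2)) s∈
    ...   | _ , _ , w≡p+2 = <-irrefl (sym w≡p+2) (n<1+n _)

  ⟦⟧-injectiveOn-smallTriples : ∀ {s t} → s ∈ smallTriples → t ∈ smallTriples →
    ⟦ s ⟧ ≡ ⟦ t ⟧ → s ≡ t
  ⟦⟧-injectiveOn-smallTriples {_ , _ , _} {_ , _ , _} s∈ t∈
    with ∈-smallTriples⁻ s∈ | ∈-smallTriples⁻ t∈
  ... | j≤b , b≤h , _ | j′≤b′ , b′≤h , _ = value-injective j≤b b≤h j′≤b′ b′≤h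

  ⟦⟧-injectiveOn-coverTriples : ∀ {s t} → s ∈ coverTriples → t ∈ coverTriples →
    ⟦ s ⟧ ≡ ⟦ t ⟧ → s ≡ t
  ⟦⟧-injectiveOn-coverTriples {a , b , j} {a′ , b′ , j′} s∈ t∈ eq
    with ∈-coverTriples⁻ s∈ | ∈-coverTriples⁻ t∈
  ... | j≤b , _ , _ , inj₁ (b≤h , _) | j′≤b′ , _ , _ , inj₁ (b′≤h , _) =
    value-injective j≤b b≤h j′≤b′ b′≤h eq
  ... | _ , _ , _ , inj₂ (refl , refl) | _ , _ , _ , inj₂ (refl , refl) =
    cong top (+-cancelˡ-≡ (suc h * g) _ _ eq)
  ... | _ , _ , _ , inj₁ (_ , below) | _ , _ , _ , inj₂ (refl , refl) =
    ⊥-elim (<⇒≱ (1+[p+1]m<value[0,h+1,j]+d j′) (subst (λ v → v + d ≤ suc ((1 + p) * m)) eq below))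
  ... | _ , _ , _ , inj₂ (refl , refl) | _ , _ , _ , inj₁ (_ , below) =
    ⊥-elim (<⇒≱ (1+[p+1]m<value[0,h+1,j]+d j) (subst (λ v → v + d ≤ suc ((1 + p) * m)) (sym eq) below))

  -- Conductor, small elements and minimal generators

  generators : List ℕ
  generators = m ∷ g ∷ suc g ∷ []

  S : Subset
  S = ⟨ generators ⟩ c

  IsValue : ℕ → Set
  IsValue x = ∃ λ a → ∃ λ b → ∃ λ j → j ≤ b × value a b j ≡ x

  sum⇒IsValue : ∀ xs → All (_∈ generators) xs → IsValue (sum xs)
  sum⇒IsValue [] [] = 0 , 0 , 0 , z≤n , refl
  sum⇒IsValue (x ∷ xs) (x∈ ∷ xs∈) with sum⇒IsValue xs xs∈ | x∈
  ... | a , b , j , j≤b , eq | here refl =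
    suc a , b , j , j≤b , trans (Identities.value-sucᵃ u τ a b j) (cong (_+_ m) eq)
  ... | a , b , j , j≤b , eq | there (here refl) =
    a , suc b , j , m≤n⇒m≤1+n j≤b , trans (Identities.value-sucᵇ u τ a b j) (cong (_+_ g) eq)
  ... | a , b , j , j≤b , eq | there (there (here refl)) =
    a , suc b , suc j , s≤s j≤b , trans (Identities.value-sucᵇʲ u τ a b j) (cong (_+_ (suc g)) eq)

  value-sum : ∀ a b j → j ≤ b → ∃ λ xs → All (_∈ generators) xs × sum xs ≡ value a b j
  value-sum (suc a) b j j≤b with value-sum a b j j≤b
  ... | xs , xs∈ , eq = m ∷ xs , here refl ∷ xs∈ , trans (cong (_+_ m) eq) (sym (Identities.value-sucᵃ u τ a b j))
  value-sum zero zero zero z≤n = [] , [] , refl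
  value-sum zero (suc b) zero _ with value-sum zero b zero z≤n
  ... | xs , xs∈ , eq =
    g ∷ xs , there (here refl) ∷ xs∈ , trans (cong (_+_ g) eq) (sym (Identities.value-sucᵇ u τ 0 b 0))
  value-sum zero (suc b) (suc j) (s≤s j≤b) with value-sum zero b j j≤b
  ... | xs , xs∈ , eq =
    suc g ∷ xs , there (there (here refl)) ∷ xs∈ ,
    trans (cong (_+_ (suc g)) eq) (sym (Identities.value-sucᵇʲ u τ 0 b j))

  value∈S : ∀ a b j → j ≤ b → S (value a b j)
  value∈S a b j j≤b = inj₂ (value-sum a b j j≤b)

  ∈S∧<c⇒IsValue : ∀ {x} → S x → x < c → IsValue x
  ∈S∧<c⇒IsValue (inj₁ c≤x) x<c = ⊥-elim (<⇒≱ x<c c≤x)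
  ∈S∧<c⇒IsValue (inj₂ (xs , xs∈ , refl)) _ = sum⇒IsValue xs xs∈

  S-conductor : IsConductor S c
  S-conductor = IsConductor-intro (≤-trans 0<m m≤c) (λ _ → inj₁) gap
    where
    gap : ∀ {x} → S x → x < c → suc x < c
    gap x∈S x<c with ∈S∧<c⇒IsValue x∈S x<c
    ... | a , b , j , j≤b , refl = proj₂ (proj₂ (∈-smallTriples⁻ (∈-smallTriples⁺ a b j j≤b x<c)))

  smallValues : List ℕ
  smallValues = map ⟦_⟧ smallTriples

  S-smallElems : HasSize (SmallElems S c) (length smallTriples)
  S-smallElems =
    smallValues , map⁺-injectiveOn ⟦_⟧ smallTriples-unique ⟦⟧-injectiveOn-smallTriples ,
    (λ x → sound , complete) , length-map ⟦_⟧ smallTriples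
    where
    sound : ∀ {x} → x ∈ smallValues → S x × x < c
    sound x∈ with ∈-map⁻ ⟦_⟧ x∈
    ... | (a , b , j) , t∈ , refl with ∈-smallTriples⁻ t∈
    ...   | j≤b , _ , v+2≤c = value∈S a b j j≤b , ≤-trans (n≤1+n _) v+2≤c
    complete : ∀ {x} → S x × x < c → x ∈ smallValues
    complete (x∈S , x<c) with ∈S∧<c⇒IsValue x∈S x<c
    ... | a , b , j , j≤b , refl = ∈-map⁺ ⟦_⟧ (∈-smallTriples⁺ a b j j≤b x<c)

  generator∈S : ∀ {x} → x ∈ generators → S x
  generator∈S {x} x∈ = inj₂ (x ∷ [] , x∈ ∷ [] , +-identityʳ x)

  generator+0 : ∀ {x v y} → x ∈ generators → v ≡ x + y → y ≡ 0 → v ∈ 0 ∷ generators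
  generator+0 x∈ refl refl = there (subst (_∈ generators) (sym (+-identityʳ _)) x∈)

  Decomposable : ℕ → Set
  Decomposable x = ∃[ y ] ∃[ z ] (S y × S z × y ≢ 0 × z ≢ 0 × y + z ≡ x)

  m<c : m < c
  m<c = <-trans m<g (≤-trans (n≤1+n _) g+2≤c)

  ∈S∧≢0⇒m≤ : ∀ {x} → S x → x ≢ 0 → m ≤ x
  ∈S∧≢0⇒m≤ (inj₁ c≤x) _ = ≤-trans m≤c c≤x
  ∈S∧≢0⇒m≤ (inj₂ (xs , xs∈ , refl)) x≢0 with sum⇒IsValue xs xs∈
  ... | suc a , b , j , _ , eq = subst (m ≤_) (trans (sym (Identities.value-sucᵃ u τ a b j)) eq) (m≤m+n m _)
  ... | zero , suc b , j , _ , eq =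
    subst (m ≤_) (trans (sym (Identities.value-sucᵇ u τ 0 b j)) eq) (≤-trans (<⇒≤ m<g) (m≤m+n g _))
  ... | zero , zero , zero , z≤n , eq = ⊥-elim (x≢0 (sym eq))

  <2m⇒¬Decomposable : ∀ {x} → x < 2 * m → ¬ Decomposable x
  <2m⇒¬Decomposable x<2m (y , z , y∈S , z∈S , y≢0 , z≢0 , refl) =
    <⇒≱ x<2m (subst (_≤ y + z) (cong (_+_ m) (sym (+-identityʳ m)))
      (+-mono-≤ (∈S∧≢0⇒m≤ y∈S y≢0) (∈S∧≢0⇒m≤ z∈S z≢0)))

  c≤x⇒x≢0 : ∀ {x} → c ≤ x → x ≢ 0
  c≤x⇒x≢0 c≤x refl = <⇒≱ (≤-trans 0<m m≤c) c≤x

  c+m≤x⇒Decomposable : ∀ {x} → c + m ≤ x → Decomposable x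
  c+m≤x⇒Decomposable {x} c+m≤x =
    m , x ∸ m , generator∈S (here refl) , inj₁ c≤x∸m ,
    (λ m≡0 → <-irrefl (sym m≡0) 0<m) , c≤x⇒x≢0 c≤x∸m , m+[n∸m]≡n (≤-trans (m≤n+m m c) c+m≤x)
    where
    c≤x∸m : c ≤ x ∸ m
    c≤x∸m = m+n≤o⇒m≤o∸n c c+m≤x

  value-Decomposable : ∀ a b j → j ≤ b → value a b j ∉ 0 ∷ generators → Decomposable (value a b j)
  value-Decomposable zero zero zero z≤n v∉ = ⊥-elim (v∉ (here refl))
  value-Decomposable (suc a) b j j≤b v∉ =
    m , value a b j , generator∈S (here refl) , value∈S a b j j≤b ,
    (λ m≡0 → <-irrefl (sym m≡0) 0<m) ,
    (λ v≡0 → v∉ (generator+0 (here refl) (Identities.value-sucᵃ u τ a b j) v≡0)) ,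
    sym (Identities.value-sucᵃ u τ a b j)
  value-Decomposable zero (suc b) j j≤b v∉ with m≤n⇒m<n∨m≡n j≤b
  ... | inj₁ (s≤s j≤b′) =
    g , value 0 b j , generator∈S (there (here refl)) , value∈S 0 b j j≤b′ ,
    (λ g≡0 → <-irrefl (sym g≡0) (≤-<-trans z≤n m<g)) ,
    (λ v≡0 → v∉ (generator+0 (there (here refl)) (Identities.value-sucᵇ u τ 0 b j) v≡0)) ,
    sym (Identities.value-sucᵇ u τ 0 b j)
  ... | inj₂ refl =
    suc g , value 0 b b , generator∈S (there (there (here refl))) , value∈S 0 b b ≤-refl ,
    (λ ()) ,
    (λ v≡0 → v∉ (generator+0 (there (there (here refl))) (Identities.value-sucᵇʲ u τ 0 b b) v≡0)) ,
    sym (Identities.value-sucᵇʲ u τ 0 b b)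

  c≤x⇒x∉0∷generators : ∀ {x} → c ≤ x → x ∉ 0 ∷ generators
  c≤x⇒x∉0∷generators c≤x (here refl) = c≤x⇒x≢0 c≤x refl
  c≤x⇒x∉0∷generators c≤x (there (here refl)) = <⇒≱ m<c c≤x
  c≤x⇒x∉0∷generators c≤x (there (there (here refl))) = <⇒≱ (≤-trans (n≤1+n _) g+2≤c) c≤x
  c≤x⇒x∉0∷generators c≤x (there (there (there (here refl)))) = <⇒≱ g+2≤c c≤x

  coverValues : List ℕ
  coverValues = map ⟦_⟧ coverTriples

  coverValues-unique : Unique coverValues
  coverValues-unique = map⁺-injectiveOn ⟦_⟧ coverTriples-unique ⟦⟧-injectiveOn-coverTriples

  ∈-coverValues⇒Decomposable : ∀ {x} → x ∈ coverValues → Decomposable x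
  ∈-coverValues⇒Decomposable x∈ with ∈-map⁻ ⟦_⟧ {xs = coverTriples} x∈
  ... | (a , b , j) , t∈ , refl with ∈-coverTriples⁻ {a} {b} {j} t∈
  ...   | j≤b , c≤v , _ = value-Decomposable a b j j≤b (c≤x⇒x∉0∷generators c≤v)

  conductorWindow : List ℕ
  conductorWindow = applyUpTo (_+_ c) m

  conductorWindow-unique : Unique conductorWindow
  conductorWindow-unique =
    Unique.applyUpTo⁺₁ (_+_ c) m (λ i<j _ c+i≡c+j → <-irrefl (+-cancelˡ-≡ c _ _ c+i≡c+j) i<j)

  ∈-conductorWindow⁺ : ∀ {x} → c ≤ x → x < c + m → x ∈ conductorWindow
  ∈-conductorWindow⁺ {x} c≤x x<c+m = subst (_∈ conductorWindow) (m+[n∸m]≡n c≤x)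
    (∈-applyUpTo⁺ (_+_ c) (+-cancelˡ-< c _ _ (subst (_< c + m) (sym (m+[n∸m]≡n c≤x)) x<c+m)))

  ∈-conductorWindow⁻ : ∀ {x} → x ∈ conductorWindow → c ≤ x × x < c + m
  ∈-conductorWindow⁻ x∈ with ∈-applyUpTo⁻ (_+_ c) x∈
  ... | i , i<m , refl = m≤m+n c i , +-monoʳ-< c i<m

  coverValues⊆conductorWindow : ∀ {x} → x ∈ coverValues → x ∈ conductorWindow
  coverValues⊆conductorWindow x∈ with ∈-map⁻ ⟦_⟧ {xs = coverTriples} x∈
  ... | (a , b , j) , t∈ , refl with ∈-coverTriples⁻ {a} {b} {j} t∈
  ...   | _ , c≤v , v<c+m , _ = ∈-conductorWindow⁺ c≤v v<c+m

  largeGenerators : List ℕ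
  largeGenerators = filter (∁? (_∈? coverValues)) conductorWindow

  minGens : List ℕ
  minGens = generators ++ largeGenerators

  ∈-largeGenerators⁻ : ∀ {x} → x ∈ largeGenerators → c ≤ x × x < c + m × x ∉ coverValues
  ∈-largeGenerators⁻ x∈ with ∈-filter⁻ (∁? (_∈? coverValues)) x∈
  ... | x∈window , x∉cover with ∈-conductorWindow⁻ x∈window
  ...   | c≤x , x<c+m = c≤x , x<c+m , x∉cover

  minGens-unique : Unique minGens
  minGens-unique =
    ((λ m≡g → <-irrefl m≡g m<g) ∷ (λ m≡g+1 → <-irrefl m≡g+1 (m≤n⇒m≤1+n m<g))
      ∷ All.tabulate (large≢ m<c))
    ∷ ((λ g≡g+1 → <-irrefl g≡g+1 ≤-refl) ∷ All.tabulate (large≢ (≤-trans (n≤1+n _) g+2≤c)))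
    ∷ All.tabulate (large≢ g+2≤c)
    ∷ Unique.filter⁺ (∁? (_∈? coverValues)) conductorWindow-unique
    where
    large≢ : ∀ {x y} → x < c → y ∈ largeGenerators → x ≢ y
    large≢ x<c y∈ refl = <⇒≱ x<c (proj₁ (∈-largeGenerators⁻ y∈))

  summand<c : ∀ {y z} → S y → y ≢ 0 → y + z < c + m → z < c
  summand<c {y} {z} y∈S y≢0 y+z<c+m =
    +-cancelʳ-< m z c (≤-<-trans (+-monoʳ-≤ z (∈S∧≢0⇒m≤ y∈S y≢0))
                                 (subst (_< c + m) (+-comm y z) y+z<c+m))

  value+value∈coverValues : ∀ {a b j a′ b′ j′} → j ≤ b → j′ ≤ b′ →
    let x = value a b j + value a′ b′ j′ in c ≤ x → x < c + m → x ∈ coverValues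
  value+value∈coverValues {a} {b} {j} {a′} {b′} {j′} j≤b j′≤b′ c≤x x<c+m =
    subst (_∈ coverValues) value-+ (∈-map⁺ ⟦_⟧
      (∈-coverTriples⁺ (a + a′) (b + b′) (j + j′) (+-mono-≤ j≤b j′≤b′)
        (subst (c ≤_) (sym value-+) c≤x) (subst (_< c + m) (sym value-+) x<c+m)))
    where
    value-+ : value (a + a′) (b + b′) (j + j′) ≡ value a b j + value a′ b′ j′
    value-+ = Identities.value-+ u τ a b j a′ b′ j′

  -- Both summands of a decomposition of x < c + m lie below c, hence are values.
  ∈-largeGenerators⇒¬Decomposable : ∀ {x} → x ∈ largeGenerators → ¬ Decomposable x
  ∈-largeGenerators⇒¬Decomposable x∈ (y , z , y∈S , z∈S , y≢0 , z≢0 , refl)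
    with ∈-largeGenerators⁻ x∈
  ... | c≤x , x<c+m , x∉cover
    with ∈S∧<c⇒IsValue y∈S (summand<c z∈S z≢0 (subst (_< c + m) (+-comm y z) x<c+m))
       | ∈S∧<c⇒IsValue z∈S (summand<c y∈S y≢0 x<c+m)
  ... | a , b , j , j≤b , refl | a′ , b′ , j′ , j′≤b′ , refl =
    x∉cover (value+value∈coverValues {a} {b} {j} {a′} j≤b j′≤b′ c≤x x<c+m)

  ∈-minGens⇒IsMinGen : ∀ {x} → x ∈ minGens → IsMinGen S x
  ∈-minGens⇒IsMinGen (here refl) =
    generator∈S (here refl) , (λ m≡0 → <-irrefl (sym m≡0) 0<m) ,
    <2m⇒¬Decomposable (<-trans m<g (≤-trans (n≤1+n _) g+2≤2m))
  ∈-minGens⇒IsMinGen (there (here refl)) =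
    generator∈S (there (here refl)) , (λ g≡0 → <-irrefl (sym g≡0) (≤-<-trans z≤n m<g)) ,
    <2m⇒¬Decomposable (≤-trans (n≤1+n _) g+2≤2m)
  ∈-minGens⇒IsMinGen (there (there (here refl))) =
    generator∈S (there (there (here refl))) , (λ ()) , <2m⇒¬Decomposable g+2≤2m
  ∈-minGens⇒IsMinGen (there (there (there x∈))) with ∈-largeGenerators⁻ x∈
  ... | c≤x , _ = inj₁ c≤x , c≤x⇒x≢0 c≤x , ∈-largeGenerators⇒¬Decomposable x∈

  IsMinGen⇒∈minGens : ∀ {x} → IsMinGen S x → x ∈ minGens
  IsMinGen⇒∈minGens {x} (x∈S , x≢0 , indecomposable) with x <? c
  ... | yes x<c with ∈S∧<c⇒IsValue x∈S x<c
  ...   | a , b , j , j≤b , refl with value a b j ∈? 0 ∷ generators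
  ...     | yes (here v≡0) = ⊥-elim (x≢0 v≡0)
  ...     | yes (there v∈) = ∈-++⁺ˡ v∈
  ...     | no v∉ = ⊥-elim (indecomposable (value-Decomposable a b j j≤b v∉))
  IsMinGen⇒∈minGens {x} (x∈S , x≢0 , indecomposable) | no x≮c with x <? c + m
  ... | no x≮c+m = ⊥-elim (indecomposable (c+m≤x⇒Decomposable (≮⇒≥ x≮c+m)))
  ... | yes x<c+m with x ∈? coverValues
  ...   | yes x∈cover = ⊥-elim (indecomposable (∈-coverValues⇒Decomposable x∈cover))
  ...   | no x∉cover = ∈-++⁺ʳ generators
    (∈-filter⁺ (∁? (_∈? coverValues)) (∈-conductorWindow⁺ (≮⇒≥ x≮c) x<c+m) x∉cover)

  S-minGens : HasSize (IsMinGen S) (3 + length largeGenerators)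
  S-minGens = minGens , minGens-unique , (λ x → ∈-minGens⇒IsMinGen , IsMinGen⇒∈minGens) , refl

  length-largeGenerators : length largeGenerators + length coverTriples ≡ m
  length-largeGenerators = begin
    length largeGenerators + length coverTriples
      ≡⟨ +-comm (length largeGenerators) _ ⟩
    length coverTriples + length largeGenerators
      ≡⟨ cong (_+ length largeGenerators) covered ⟨
    length (filter (_∈? coverValues) conductorWindow) + length largeGenerators
      ≡⟨ length-filter+length-filter-∁ (_∈? coverValues) conductorWindow ⟩
    length conductorWindow
      ≡⟨ length-applyUpTo (_+_ c) m ⟩
    m ∎
    where
    open ≡-Reasoning
    covered : length (filter (_∈? coverValues) conductorWindow) ≡ length coverTriples
    covered = trans
      (same-members⇒length-≡ (Unique.filter⁺ (_∈? coverValues) conductorWindow-unique) coverValues-unique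
        (λ x∈ → proj₂ (∈-filter⁻ (_∈? coverValues) {xs = conductorWindow} x∈))
        (λ x∈ → ∈-filter⁺ (_∈? coverValues) (coverValues⊆conductorWindow x∈) x∈))
      (length-map ⟦_⟧ coverTriples)

module _ (u τ : ℕ) where
  open Params u τ

  half-p : suc u * 2 / 2 ≡ h
  half-p = m*n/n≡m (suc u) 2

  mP≡m : mP (suc u * 2) τ ≡ m
  mP≡m = trans (cong (λ x → x * x + 2 * (suc u * 2) + 2 + τ * x) half-p) (expand u τ)
    where
    expand : ∀ u τ → (1 + u) * (1 + u) + 2 * ((1 + u) * 2) + 2 + τ * (1 + u) ≡ (1 + u) * (u + 5 + τ) + 2
    expand = solve-∀

  gP≡g : gP (suc u * 2) τ ≡ g
  gP≡g = begin
    gP (suc u * 2) τ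
      ≡⟨ cong (λ x → 2 * (x * x + 2 * (suc u * 2) + 2) ∸ (x + 4) + τ * suc (u * 2)) half-p ⟩
    2 * (h * h + 2 * (h * 2) + 2) ∸ (h + 4) + τ * suc (u * 2)
      ≡⟨ cong (λ x → x ∸ (h + 4) + τ * suc (u * 2)) (twice-μ u) ⟩
    γ₀ + (h + 4) ∸ (h + 4) + τ * suc (u * 2)
      ≡⟨ cong (_+ τ * suc (u * 2)) (m+n∸n≡m γ₀ (h + 4)) ⟩
    γ₀ + τ * suc (u * 2)
      ≡⟨ expand u τ ⟩
    g ∎
    where
    open ≡-Reasoning
    γ₀ : ℕ
    γ₀ = 2 * u * u + 11 * u + 9
    twice-μ : ∀ u → 2 * ((1 + u) * (1 + u) + 2 * ((1 + u) * 2) + 2) ≡ (2 * u * u + 11 * u + 9) + ((1 + u) + 4)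
    twice-μ = solve-∀
    expand : ∀ u τ → (2 * u * u + 11 * u + 9) + τ * (1 + u * 2) ≡ (2 * u + 1) * (u + 5 + τ) + 4
    expand = solve-∀

  cP≡c : cP (suc u * 2) τ ≡ c
  cP≡c = begin
    cP (suc u * 2) τ
      ≡⟨ cong₂ (λ x y → suc u * 2 * (x * x + 2 * (suc u * 2) + 2) + τ * (y ∸ 1)) half-p half-p² ⟩
    h * 2 * (h * h + 2 * (h * 2) + 2) + τ * (h * h * 2 ∸ 1)
      ≡⟨ cong (λ y → h * 2 * (h * h + 2 * (h * 2) + 2) + τ * (y ∸ 1)) (twice-h² u) ⟩
    h * 2 * (h * h + 2 * (h * 2) + 2) + τ * (2 * u * u + 4 * u + 1)
      ≡⟨ expand u τ ⟩
    c ∎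
    where
    open ≡-Reasoning
    half-p² : (suc u * 2 * (suc u * 2)) / 2 ≡ h * h * 2
    half-p² = trans (cong (_/ 2) (square u)) (m*n/n≡m (h * h * 2) 2)
      where
      square : ∀ u → (1 + u) * 2 * ((1 + u) * 2) ≡ (1 + u) * (1 + u) * 2 * 2
      square = solve-∀
    twice-h² : ∀ u → (1 + u) * (1 + u) * 2 ≡ 1 + (2 * u * u + 4 * u + 1)
    twice-h² = solve-∀
    expand : ∀ u τ → (1 + u) * 2 * ((1 + u) * (1 + u) + 2 * ((1 + u) * 2) + 2) + τ * (2 * u * u + 4 * u + 1)
      ≡ (2 * u * u + 4 * u + 1) * (u + 5 + τ) + 5 * u + 9
    expand = solve-∀

  Spt≡S : Spt (suc u * 2) τ ≡ Family.S u τ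
  Spt≡S =
    trans (cong (λ x → ⟨ x ∷ gP (suc u * 2) τ ∷ suc (gP (suc u * 2) τ) ∷ [] ⟩ cP (suc u * 2) τ) mP≡m)
          (cong₂ (λ y z → ⟨ m ∷ y ∷ suc y ∷ [] ⟩ z) gP≡g cP≡c)

module _ (u : ℕ) where
  open Params u 0 using (h; p)

  length-smallTriples : ∀ τ → 6 * length (Family.smallTriples u τ) ≡ 2 * h * h * h + 9 * h * h + 13 * h
  length-smallTriples τ = begin
    6 * length (weightBelow p ++ layer₊ (u * 2))
      ≡⟨ cong (6 *_) (trans (length-++ (weightBelow p))
           (cong (_+_ F) (trans (length-layer₊ (u * 2)) (cong (_+_ Λ) (length-pairsOfWeight-even u))))) ⟩
    6 * (F + (Λ + h))
      ≡⟨ regroup F Λ h ⟩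
    2 * (3 * F) + 3 * (2 * Λ) + 6 * h
      ≡⟨ cong₂ (λ x y → 2 * x + 3 * y + 6 * h) (length-weightBelow h) (length-layer-even u) ⟩
    2 * (h * (1 + h) * (2 + h)) + 3 * (h * (1 + h)) + 6 * h
      ≡⟨ expand h ⟩
    2 * h * h * h + 9 * h * h + 13 * h ∎
    where
    open ≡-Reasoning
    F Λ : ℕ
    F = length (weightBelow p)
    Λ = length (layer (u * 2))
    regroup : ∀ F Λ h → 6 * (F + (Λ + h)) ≡ 2 * (3 * F) + 3 * (2 * Λ) + 6 * h
    regroup = solve-∀
    expand : ∀ h → 2 * (h * (1 + h) * (2 + h)) + 3 * (h * (1 + h)) + 6 * h ≡ 2 * h * h * h + 9 * h * h + 13 * h
    expand = solve-∀

  length-coverTriples : ∀ τ → 2 * length (Family.coverTriples u τ) ≡ (2 + h) * (3 + h)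
  length-coverTriples τ = begin
    2 * suc (length (layer₊ (suc (u * 2)) ++ map top (upTo (2 + h))))
      ≡⟨ cong (λ l → 2 * suc l) (trans (length-++ (layer₊ (suc (u * 2))))
           (cong₂ _+_ (trans (length-layer₊ (suc (u * 2)))
                             (cong₂ _+_ (length-layer-odd u) (length-pairsOfWeight-odd u)))
                      (trans (length-map top (upTo (2 + h))) (length-upTo (2 + h))))) ⟩
    2 * suc ((Λ + h) + (2 + h))
      ≡⟨ regroup Λ h ⟩
    2 * Λ + (4 * h + 6)
      ≡⟨ cong (_+ (4 * h + 6)) (length-layer-even u) ⟩
    h * (1 + h) + (4 * h + 6)
      ≡⟨ expand h ⟩
    (2 + h) * (3 + h) ∎
    where
    open ≡-Reasoning
    open Family u τ using (top)
    Λ : ℕ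
    Λ = length (layer (u * 2))
    regroup : ∀ Λ h → 2 * suc ((Λ + h) + (2 + h)) ≡ 2 * Λ + (4 * h + 6)
    regroup = solve-∀
    expand : ∀ h → h * (1 + h) + (4 * h + 6) ≡ (2 + h) * (3 + h)
    expand = solve-∀

-- The Wilf number

module _ (u τ : ℕ) where
  open Params u τ
  open Family u τ using (S; smallTriples; largeGenerators; S-conductor; S-smallElems; S-minGens; length-largeGenerators)

  nMinGens nSmallElems : ℕ
  nMinGens = 3 + length largeGenerators
  nSmallElems = length smallTriples

  wilf : ℤ
  wilf = + (nMinGens * nSmallElems) ℤ.- + c

  S-IsWilf : IsWilf S wilf
  S-IsWilf = c , nSmallElems , nMinGens , S-conductor , S-smallElems , S-minGens , refl

  twice-nMinGens : 2 * nMinGens ≡ h * h + 3 * h + 4 + 2 * τ * h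
  twice-nMinGens = +-cancelʳ-≡ ((2 + h) * (3 + h)) _ _ (begin
    2 * (3 + N) + (2 + h) * (3 + h)        ≡⟨ cong (_+_ (2 * (3 + N))) (length-coverTriples u τ) ⟨
    2 * (3 + N) + 2 * C                    ≡⟨ regroup N C ⟩
    6 + 2 * (N + C)                        ≡⟨ cong (λ x → 6 + 2 * x) length-largeGenerators ⟩
    6 + 2 * m                              ≡⟨ expand u τ ⟩
    h * h + 3 * h + 4 + 2 * τ * h + (2 + h) * (3 + h) ∎)
    where
    open ≡-Reasoning
    N C : ℕ
    N = length largeGenerators
    C = length (Family.coverTriples u τ)
    regroup : ∀ N C → 2 * (3 + N) + 2 * C ≡ 6 + 2 * (N + C)
    regroup = solve-∀
    expand : ∀ u τ → 6 + 2 * ((1 + u) * (u + 5 + τ) + 2)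
      ≡ (1 + u) * (1 + u) + 3 * (1 + u) + 4 + 2 * τ * (1 + u) + (2 + (1 + u)) * (3 + (1 + u))
    expand = solve-∀

  48*nMinGens*nSmallElems : 48 * (nMinGens * nSmallElems)
    ≡ 4 * (h * h + 3 * h + 4 + 2 * τ * h) * (2 * h * h * h + 9 * h * h + 13 * h)
  48*nMinGens*nSmallElems = trans (regroup nMinGens nSmallElems)
    (cong₂ (λ x y → 4 * x * y) twice-nMinGens (length-smallTriples u τ))
    where
    regroup : ∀ K L → 48 * (K * L) ≡ 4 * (2 * K) * (6 * L)
    regroup = solve-∀

  wilf-positive : + 0 ℤ.< wilf
  wilf-positive = n<m⇒0<+m-+n (*-cancelˡ-≤ 12 (begin
    12 * suc c                           ≤⟨ ≤-by-slack₀ (slack u τ) ⟩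
    Q * R                                ≡⟨ cong₂ _*_ twice-nMinGens (length-smallTriples u τ) ⟨
    2 * K * (6 * L)                      ≡⟨ regroup K L ⟩
    12 * (K * L)                         ∎))
    where
    open ≤-Reasoning
    K L Q R : ℕ
    K = nMinGens
    L = nSmallElems
    Q = h * h + 3 * h + 4 + 2 * τ * h
    R = 2 * h * h * h + 9 * h * h + 13 * h
    regroup : ∀ K L → 2 * K * (6 * L) ≡ 12 * (K * L)
    regroup = solve-∀
    slack : ∀ u τ → 12 * suc ((2 * u * u + 4 * u + 1) * (u + 5 + τ) + 5 * u + 9)
      + (12 + 104 * u + 36 * τ + 161 * u * u + 74 * u * τ + 104 * u * u * u + 80 * u * u * τ
         + 25 * u * u * u * u + 34 * u * u * u * τ + 2 * u * u * u * u * u + 4 * u * u * u * u * τ)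
      ≡ ((1 + u) * (1 + u) + 3 * (1 + u) + 4 + 2 * τ * (1 + u))
        * (2 * (1 + u) * (1 + u) * (1 + u) + 9 * (1 + u) * (1 + u) + 13 * (1 + u))
    slack = solve-∀

wilfIncrement : ℕ → ℕ
wilfIncrement p = p ^ 4 + 9 * p ^ 3 + 2 * p ^ 2 + 48

wilf-shift : ∀ u τ → + 48 ℤ.* wilf u τ ≡ + 48 ℤ.* wilf u 0 ℤ.+ + τ ℤ.* + wilfIncrement (suc u * 2)
wilf-shift u τ =
  trans (*-difference-shift 48 {A τ} {c τ} {A 0} {c 0} equation)
        (cong (ℤ._+_ (+ 48 ℤ.* wilf u 0)) (ℤ.pos-* τ _))
  where
  open ≡-Reasoning
  open Params u 0 using (h)
  A c Q : ℕ → ℕ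
  A t = nMinGens u t * nSmallElems u t
  c t = Params.c u t
  Q t = h * h + 3 * h + 4 + 2 * t * h
  R : ℕ
  R = 2 * h * h * h + 9 * h * h + 13 * h
  -- p ^ n unfolds to the iterated product p * (⋯ * (p * 1)), which the solver can read.
  polynomial : ∀ u τ → let h = 1 + u ; p = h * 2 in
    4 * (h * h + 3 * h + 4 + 2 * τ * h) * (2 * h * h * h + 9 * h * h + 13 * h)
      + 48 * ((2 * u * u + 4 * u + 1) * (u + 5 + 0) + 5 * u + 9)
    ≡ 4 * (h * h + 3 * h + 4 + 2 * 0 * h) * (2 * h * h * h + 9 * h * h + 13 * h)
      + 48 * ((2 * u * u + 4 * u + 1) * (u + 5 + τ) + 5 * u + 9)
      + τ * (p * (p * (p * (p * 1))) + 9 * (p * (p * (p * 1))) + 2 * (p * (p * 1)) + 48)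
  polynomial = solve-∀
  equation : 48 * A τ + 48 * c 0 ≡ 48 * A 0 + 48 * c τ + τ * wilfIncrement (suc u * 2)
  equation = begin
    48 * A τ + 48 * c 0
      ≡⟨ cong (_+ 48 * c 0) (48*nMinGens*nSmallElems u τ) ⟩
    4 * Q τ * R + 48 * c 0
      ≡⟨ polynomial u τ ⟩
    4 * Q 0 * R + 48 * c τ + τ * wilfIncrement (suc u * 2)
      ≡⟨ cong (λ x → x + 48 * c τ + τ * wilfIncrement (suc u * 2)) (48*nMinGens*nSmallElems u 0) ⟨
    48 * A 0 + 48 * c τ + τ * wilfIncrement (suc u * 2) ∎

proposition4p13 : (p τ : ℕ) → 0 < p → 2 ∣ p →
    (∃[ w ] IsWilf (Spt p τ) w)
    × (∀ w w₀ → IsWilf (Spt p τ) w → IsWilf (Spt p 0) w₀ →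
         (+ 48) ℤ.* w ≡ (+ 48) ℤ.* w₀
           ℤ.+ (+ τ) ℤ.* (+ (p ^ 4 + 9 * p ^ 3 + 2 * p ^ 2 + 48)))
    × (∀ w → IsWilf (Spt p τ) w → (+ 0) ℤ.< w)
proposition4p13 p τ 0<p (divides zero refl) = ⊥-elim (<-irrefl refl 0<p)
proposition4p13 p τ _ (divides (suc u) refl) =
  (wilf u τ , IsWilf-Spt τ) ,
  (λ w w₀ W W₀ → subst₂ (λ x y → + 48 ℤ.* x ≡ + 48 ℤ.* y ℤ.+ + τ ℤ.* + wilfIncrement (suc u * 2))
                   (sym (wilf-Spt τ W)) (sym (wilf-Spt 0 W₀)) (wilf-shift u τ)) ,
  (λ w W → subst (+ 0 ℤ.<_) (sym (wilf-Spt τ W)) (wilf-positive u τ))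
  where
  IsWilf-Spt : ∀ t → IsWilf (Spt (suc u * 2) t) (wilf u t)
  IsWilf-Spt t = subst (λ S → IsWilf S (wilf u t)) (sym (Spt≡S u t)) (S-IsWilf u t)
  wilf-Spt : ∀ t {w} → IsWilf (Spt (suc u * 2) t) w → w ≡ wilf u t
  wilf-Spt t W = IsWilf-unique W (IsWilf-Spt t)
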